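{- For every $\varepsilon > 0$ there exists $r_0$ such that for every $r \ge r_0$ there is an integer $n = n(\varepsilon, r)$ and an $r$-edge-coloured graph $G$ on $n$ vertices with $\delta(G) \ge (1-4\varepsilon)n$ whose vertices cannot be covered by fewer than $\frac{\varepsilon^2 (r-1)^2}{4}$ monochromatic trees.
   Context: A monochromatic tree is a tree (possibly a single vertex) all of whose edges have the same colour.
   Formalization: The parameter ε ranges only over the positive rationals. -}

module Defs where

open import Data.Nat using (ℕ)
open import Data.Empty using (⊥)
open import Data.Bool using (Bool; true)
open import Data.Fin using (Fin)
open import Data.List using (List; []; _∷_; length; filterᵇ; allFin)
open import Data.List.Membership.Propositional using (_∈_; _∉_)
open import Data.Product using (Σ; ∃; _×_; proj₁; proj₂)
open import Data.Integer using (+_)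
open import Data.Rational using (ℚ; _/_)
open import Relation.Binary.PropositionalEquality using (_≡_)

toℚ : ℕ → ℚ
toℚ k = + k / 1

-- A simple graph on vertex set Fin n together with an r-edge-colouring.
-- adj u v = true means uv is an edge; the colouring is only meaningful on edges.
record ColouredGraph (n r : ℕ) : Set where
  field
    adj      : Fin n → Fin n → Bool
    adj-sym  : ∀ u v → adj u v ≡ adj v u
    adj-irr  : ∀ u → adj u u ≡ true → ⊥
    colour   : Fin n → Fin n → Fin r
    colour-sym : ∀ u v → adj u v ≡ true → colour u v ≡ colour v u
  degree : Fin n → ℕ
  degree u = length (filterᵇ (adj u) (allFin n))

open ColouredGraph public

-- MonoTree G i T : T is the vertex list of a tree in G all of whose edges
-- have colour i.
data MonoTree {n r : ℕ} (G : ColouredGraph n r) (i : Fin r) : List (Fin n) → Set where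
  single : (v : Fin n) → MonoTree G i (v ∷ [])
  grow   : {T : List (Fin n)} → MonoTree G i T →
           (u v : Fin n) → u ∈ T → v ∉ T →
           adj G u v ≡ true → colour G u v ≡ i →
           MonoTree G i (v ∷ T)

MonochromaticTree : {n r : ℕ} → ColouredGraph n r → Set
MonochromaticTree {n} {r} G = Σ (Fin r) λ i → Σ (List (Fin n)) λ T → MonoTree G i T

treeVertices : {n r : ℕ} {G : ColouredGraph n r} → MonochromaticTree G → List (Fin n)
treeVertices t = proj₁ (proj₂ t)

Covers : {n r : ℕ} (G : ColouredGraph n r) (m : ℕ) → (Fin m → MonochromaticTree G) → Set
Covers {n} G m ts = (v : Fin n) → ∃ λ j → v ∈ treeVertices (ts j)

{-# OPTIONS --safe #-}
module Submission where

-- Vertices are the words in {blank, 1, …, L}^r, where a word with more than b = ⌊r/2⌋ blanks has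
-- its blanks replaced by a fixed label. Distinct words are adjacent when they carry the same label
-- at some coordinate, and the edge gets the first such coordinate as its colour. Then every
-- monochromatic tree lies in a set {w : w c = ℓ}: take c to be the colour of its edges, or any
-- labelled coordinate of a single vertex. Given fewer than (b+1)L trees, the word that at each
-- coordinate c takes a label ℓ with no tree in {w : w c = ℓ}, and a blank if there is none, has at
-- most b blanks (each blank coordinate uses up L trees), so it is a vertex that no tree covers.
-- A vertex with a ≥ r - b labelled coordinates has at most L^a (L+1)^(r-a) ≤ L n / (L + r - b)
-- non-neighbours besides itself, by Bernoulli's inequality. Taking L ≈ ε² r / 2 gives minimum
-- degree at least (1 - 4ε) n and forces ε² r² / 4 trees in every cover.

open import Defs
open import Data.Nat as ℕ using (ℕ)
open import Data.Fin using (Fin)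

module Counting where

  open import Data.Bool using (Bool; true; false; not; _∧_; _∨_)
  open import Data.Fin using (zero; suc; splitAt; remQuot)
  open import Data.Fin.Base using (finToFun; quotRem)
  open import Data.Fin.Properties using (_≟_)
  open import Data.List using (length; filterᵇ; tabulate; []; _∷_)
  open import Data.Maybe using (Maybe; just; nothing)
  import Data.Maybe as Maybe
  open import Data.Nat using (zero; suc; _+_; _*_; _^_; _≤_; _<_; z≤n; s≤s)
  open import Data.Nat.Properties hiding (_≟_)
  open import Data.Nat.Tactic.RingSolver using (solve-∀; solve)
  open import Data.Product using (∃; _×_; _,_; proj₁; proj₂)
  import Data.Product as Product
  open import Data.Sum using (_⊎_; inj₁; inj₂; [_,_]′)
  import Data.Sum as Sum
  open import Data.Vec.Functional using (foldr)
  open import Function using (_∘_; id)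
  open import Relation.Binary.PropositionalEquality
  open import Relation.Nullary.Decidable using (yes; no; does; dec-true; dec-false)

  open import Algebra.Properties.Semiring.Sum +-*-semiring public
    using (sum; sum-syntax; sum-cong-≗; ∑-distrib-+; ∑-comm; *-distribˡ-sum; *-distribʳ-sum)
  open import Algebra.Properties.Monoid.Sum *-1-monoid public
    using () renaming (sum to product; sum-cong-≗ to product-cong-≗)

  ∑-mono-≤ : ∀ {n} {f g : Fin n → ℕ} → (∀ i → f i ≤ g i) → sum f ≤ sum g
  ∑-mono-≤ {zero}  f≤g = z≤n
  ∑-mono-≤ {suc n} f≤g = +-mono-≤ (f≤g zero) (∑-mono-≤ (f≤g ∘ suc))

  ∑-const : ∀ n c → ∑[ i < n ] c ≡ n * c
  ∑-const zero    c = refl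
  ∑-const (suc n) c = cong (c +_) (∑-const n c)

  ∑-splitAt : ∀ m {n} (f : Fin m ⊎ Fin n → ℕ) →
              ∑[ i < m + n ] f (splitAt m i) ≡ ∑[ i < m ] f (inj₁ i) + ∑[ j < n ] f (inj₂ j)
  ∑-splitAt zero    f = refl
  ∑-splitAt (suc m) f = trans (cong (f (inj₁ zero) +_) (∑-splitAt m (f ∘ Sum.map₁ suc)))
                              (sym (+-assoc (f (inj₁ zero)) _ _))

  ∑-remQuot : ∀ m n (f : Fin m × Fin n → ℕ) →
              ∑[ i < m * n ] f (remQuot n i) ≡ ∑[ i < m ] ∑[ j < n ] f (i , j)
  ∑-remQuot zero    n f = refl
  ∑-remQuot (suc m) n f =
    trans (∑-splitAt n (f ∘ Product.swap ∘ [ (_, zero) , Product.map₂ suc ∘ quotRem {m} n ]′))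
          (cong (∑[ j < n ] f (zero , j) +_) (∑-remQuot m n (f ∘ Product.map₁ suc)))

  does-≟-sym : ∀ {n} (i j : Fin n) → does (i ≟ j) ≡ does (j ≟ i)
  does-≟-sym i j with i ≟ j
  ... | yes refl = sym (dec-true (i ≟ i) refl)
  ... | no  i≢j  = sym (dec-false (j ≟ i) (i≢j ∘ sym))

  indicator : Bool → ℕ
  indicator true  = 1
  indicator false = 0

  indicator-∧ : ∀ x y → indicator (x ∧ y) ≡ indicator x * indicator y
  indicator-∧ true  y = sym (+-identityʳ (indicator y))
  indicator-∧ false y = refl

  count : ∀ {n} → (Fin n → Bool) → ℕ
  count {n} p = ∑[ i < n ] indicator (p i)

  count-false : ∀ {n} {p : Fin n → Bool} → (∀ i → p i ≡ false) → count p ≡ 0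
  count-false {zero}  p≡false = refl
  count-false {suc n} p≡false rewrite p≡false zero = count-false (p≡false ∘ suc)

  count-complement : ∀ {n} (p : Fin n → Bool) → count p + count (not ∘ p) ≡ n
  count-complement {n} p = begin
    count p + count (not ∘ p)
      ≡⟨ ∑-distrib-+ (indicator ∘ p) (indicator ∘ not ∘ p) ⟨
    ∑[ i < n ] (indicator (p i) + indicator (not (p i)))
      ≡⟨ sum-cong-≗ (λ i → excluded-middle (p i)) ⟩
    ∑[ i < n ] 1
      ≡⟨ ∑-const n 1 ⟩
    n * 1
      ≡⟨ *-identityʳ n ⟩
    n ∎
    where
    open ≡-Reasoning
    excluded-middle : ∀ x → indicator x + indicator (not x) ≡ 1
    excluded-middle true  = refl
    excluded-middle false = refl

  count-mono-≤ : ∀ {n} {p q : Fin n → Bool} → (∀ i → p i ≡ true → q i ≡ true) →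
                 count p ≤ count q
  count-mono-≤ {p = p} {q} p⇒q = ∑-mono-≤ λ i → indicator-mono (p i) (q i) (p⇒q i)
    where
    indicator-mono : ∀ x y → (x ≡ true → y ≡ true) → indicator x ≤ indicator y
    indicator-mono false y x⇒y = z≤n
    indicator-mono true  y x⇒y rewrite x⇒y refl = ≤-refl

  count-∨ : ∀ {n} (p q : Fin n → Bool) → count (λ i → p i ∨ q i) ≤ count p + count q
  count-∨ p q = ≤-trans (∑-mono-≤ λ i → indicator-∨ (p i) (q i))
                        (≤-reflexive (∑-distrib-+ (indicator ∘ p) (indicator ∘ q)))
    where
    indicator-∨ : ∀ x y → indicator (x ∨ y) ≤ indicator x + indicator y
    indicator-∨ true  y = s≤s z≤n
    indicator-∨ false y = ≤-refl

  count-≟ : ∀ {n} (i : Fin n) → count (λ j → does (i ≟ j)) ≡ 1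
  count-≟ {suc n} zero    = cong suc (count-false {n} λ _ → refl)
  count-≟ {suc n} (suc i) = count-≟ i

  true⇒1≤count : ∀ {n} (p : Fin n → Bool) {i} → p i ≡ true → 1 ≤ count p
  true⇒1≤count p {zero}  pi≡true rewrite pi≡true = s≤s z≤n
  true⇒1≤count p {suc i} pi≡true = ≤-trans (true⇒1≤count (p ∘ suc) pi≡true) (m≤n+m _ _)

  count<n⇒false : ∀ {n} (p : Fin n → Bool) → count p < n → ∃ λ i → p i ≡ false
  count<n⇒false {suc n} p count<n with p zero in p0
  ... | false = zero , p0
  ... | true  = Product.map suc id (count<n⇒false (p ∘ suc) (≤-pred count<n))

  length-filterᵇ-tabulate : ∀ {A : Set} {n} (p : A → Bool) (f : Fin n → A) →
                            length (filterᵇ p (tabulate f)) ≡ count (p ∘ f)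
  length-filterᵇ-tabulate {n = zero}  p f = refl
  length-filterᵇ-tabulate {n = suc n} p f with p (f zero)
  ... | true  = cong suc (length-filterᵇ-tabulate p (f ∘ suc))
  ... | false = length-filterᵇ-tabulate p (f ∘ suc)

  ∑-fibres : ∀ {m r L} (a : Fin m → Fin r) (b : Fin m → Fin L) →
             ∑[ c < r ] ∑[ ℓ < L ] count (λ j → does (a j ≟ c) ∧ does (b j ≟ ℓ)) ≡ m
  ∑-fibres {m} {r} {L} a b = begin
    ∑[ c < r ] ∑[ ℓ < L ] ∑[ j < m ] fibre j c ℓ
      ≡⟨ sum-cong-≗ {r} (λ c → ∑-comm (λ ℓ j → fibre j c ℓ)) ⟩
    ∑[ c < r ] ∑[ j < m ] ∑[ ℓ < L ] fibre j c ℓ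
      ≡⟨ ∑-comm (λ c j → ∑[ ℓ < L ] fibre j c ℓ) ⟩
    ∑[ j < m ] ∑[ c < r ] ∑[ ℓ < L ] fibre j c ℓ
      ≡⟨ sum-cong-≗ {m} (λ j → ∑[c]∑[ℓ]fibre≡1 j) ⟩
    ∑[ j < m ] 1
      ≡⟨ ∑-const m 1 ⟩
    m * 1
      ≡⟨ *-identityʳ m ⟩
    m ∎
    where
    open ≡-Reasoning
    α : Fin m → Fin r → ℕ
    α j c = indicator (does (a j ≟ c))
    β : Fin m → Fin L → ℕ
    β j ℓ = indicator (does (b j ≟ ℓ))
    fibre : Fin m → Fin r → Fin L → ℕ
    fibre j c ℓ = indicator (does (a j ≟ c) ∧ does (b j ≟ ℓ))
    ∑[c]∑[ℓ]fibre≡1 : ∀ j → ∑[ c < r ] ∑[ ℓ < L ] fibre j c ℓ ≡ 1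
    ∑[c]∑[ℓ]fibre≡1 j = begin
      ∑[ c < r ] ∑[ ℓ < L ] fibre j c ℓ
        ≡⟨ sum-cong-≗ {r} (λ c → sum-cong-≗ {L} λ ℓ →
             indicator-∧ (does (a j ≟ c)) (does (b j ≟ ℓ))) ⟩
      ∑[ c < r ] ∑[ ℓ < L ] (α j c * β j ℓ)
        ≡⟨ sum-cong-≗ {r} (λ c → *-distribˡ-sum {L} (α j c) (β j)) ⟨
      ∑[ c < r ] (α j c * ∑[ ℓ < L ] β j ℓ)
        ≡⟨ *-distribʳ-sum {r} (∑[ ℓ < L ] β j ℓ) (α j) ⟨
      ∑[ c < r ] α j c * ∑[ ℓ < L ] β j ℓ
        ≡⟨ cong₂ _*_ (count-≟ (a j)) (count-≟ (b j)) ⟩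
      1 ∎

  full-colours-bound : ∀ {m r L} (key : Fin m → Fin r × Fin L) (full : Fin r → Bool) →
                       (∀ c → full c ≡ true → ∀ ℓ → ∃ λ j → key j ≡ (c , ℓ)) →
                       L * count full ≤ m
  full-colours-bound {m} {r} {L} key full full⇒hit = begin
    L * count full
      ≡⟨ *-distribˡ-sum {r} L _ ⟩
    ∑[ c < r ] (L * indicator (full c))
      ≤⟨ ∑-mono-≤ {r} (λ c → fibres-at c (full c) refl) ⟩
    ∑[ c < r ] ∑[ ℓ < L ] count (hits c ℓ)
      ≡⟨ ∑-fibres (proj₁ ∘ key) (proj₂ ∘ key) ⟩
    m ∎
    where
    open ≤-Reasoning
    hits : Fin r → Fin L → Fin m → Bool
    hits c ℓ j = does (proj₁ (key j) ≟ c) ∧ does (proj₂ (key j) ≟ ℓ)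
    hit⇒1≤count : ∀ c ℓ → (∃ λ j → key j ≡ (c , ℓ)) → 1 ≤ count (hits c ℓ)
    hit⇒1≤count c ℓ (j , refl) = true⇒1≤count (hits c ℓ) {j}
      (cong₂ _∧_ (dec-true (c ≟ c) refl) (dec-true (ℓ ≟ ℓ) refl))
    fibres-at : ∀ c x → full c ≡ x → L * indicator x ≤ ∑[ ℓ < L ] count (hits c ℓ)
    fibres-at c false _      = ≤-trans (≤-reflexive (*-zeroʳ L)) z≤n
    fibres-at c true  full-c = begin
      L * 1
        ≡⟨ ∑-const L 1 ⟨
      ∑[ ℓ < L ] 1
        ≤⟨ ∑-mono-≤ {L} (λ ℓ → hit⇒1≤count c ℓ (full⇒hit c full-c ℓ)) ⟩
      ∑[ ℓ < L ] count (hits c ℓ) ∎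

  allᵇ : ∀ {n} → (Fin n → Bool) → Bool
  allᵇ = foldr _∧_ true

  allᵇ-true : ∀ {n} {p : Fin n → Bool} → (∀ i → p i ≡ true) → allᵇ p ≡ true
  allᵇ-true {zero}  p≡true = refl
  allᵇ-true {suc n} p≡true rewrite p≡true zero = allᵇ-true (p≡true ∘ suc)

  count-allᵇ-finToFun : ∀ {m} r (P : Fin r → Fin m → Bool) →
                        count {m ^ r} (λ v → allᵇ λ c → P c (finToFun v c)) ≡ product (count ∘ P)
  count-allᵇ-finToFun         zero    P = refl
  count-allᵇ-finToFun {m = m} (suc r) P = begin
    count {m ^ suc r} (λ v → allᵇ λ c → P c (finToFun v c))
      ≡⟨ ∑-remQuot m (m ^ r) (λ (x , y) → indicator (P zero x ∧ A y)) ⟩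
    ∑[ x < m ] ∑[ y < m ^ r ] indicator (P zero x ∧ A y)
      ≡⟨ sum-cong-≗ {m} (λ x → sum-cong-≗ {m ^ r} λ y → indicator-∧ (P zero x) (A y)) ⟩
    ∑[ x < m ] ∑[ y < m ^ r ] (indicator (P zero x) * indicator (A y))
      ≡⟨ sum-cong-≗ {m} (λ x → *-distribˡ-sum {m ^ r} (indicator (P zero x)) _) ⟨
    ∑[ x < m ] (indicator (P zero x) * count A)
      ≡⟨ *-distribʳ-sum {m} (count A) _ ⟨
    count (P zero) * count A
      ≡⟨ cong (count (P zero) *_) (count-allᵇ-finToFun r (P ∘ suc)) ⟩
    product (count ∘ P) ∎
    where
    open ≡-Reasoning
    A : Fin (m ^ r) → Bool
    A y = allᵇ λ c → P (suc c) (finToFun y c)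

  product≤^ : ∀ {n m} {f : Fin n → ℕ} → (∀ i → f i ≤ m) → product f ≤ m ^ n
  product≤^ {zero}  f≤m = ≤-refl
  product≤^ {suc n} f≤m = *-mono-≤ (f≤m zero) (product≤^ (f≤m ∘ suc))

  -- With a = count (not ∘ Q) this reads L^a (L+1)^(r-a) (L+a) ≤ L (L+1)^r,
  -- i.e. Bernoulli's inequality (1 + 1/L)^a ≥ 1 + a/L.
  bernoulli : ∀ L {r} (Q : Fin r → Bool) →
              product (λ c → indicator (Q c) + L) * (L + count (not ∘ Q)) ≤ L * suc L ^ r
  bernoulli L {zero}  Q = ≤-reflexive (solve (L ∷ []))
  bernoulli L {suc r} Q = step (Q zero)
    where
    open ≤-Reasoning
    P a X : ℕ
    P = product (λ c → indicator (Q (suc c)) + L)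
    a = count (not ∘ Q ∘ suc)
    X = suc L ^ r
    P*[L+a]≤L*X : P * (L + a) ≤ L * X
    P*[L+a]≤L*X = bernoulli L (Q ∘ suc)
    P≤X : P ≤ X
    P≤X = product≤^ λ i → +-monoˡ-≤ L (indicator≤1 (Q (suc i)))
      where
      indicator≤1 : ∀ x → indicator x ≤ 1
      indicator≤1 true  = ≤-refl
      indicator≤1 false = z≤n
    step : ∀ x → (indicator x + L) * P * (L + (indicator (not x) + a)) ≤ L * (suc L * X)
    step true = begin
      suc L * P * (L + a)    ≡⟨ *-assoc (suc L) P (L + a) ⟩
      suc L * (P * (L + a))  ≤⟨ *-monoʳ-≤ (suc L) P*[L+a]≤L*X ⟩
      suc L * (L * X)        ≡⟨ swap-factors (suc L) L X ⟩
      L * (suc L * X)        ∎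
      where
      swap-factors : ∀ x y z → x * (y * z) ≡ y * (x * z)
      swap-factors = solve-∀
    step false = begin
      L * P * (L + suc a)    ≡⟨ expand L P a ⟩
      L * (P * (L + a) + P)  ≤⟨ *-monoʳ-≤ L (+-mono-≤ P*[L+a]≤L*X P≤X) ⟩
      L * (L * X + X)        ≡⟨ cong (L *_) (+-comm (L * X) X) ⟩
      L * (suc L * X)        ∎
      where
      expand : ∀ L P a → L * P * (L + suc a) ≡ L * (P * (L + a) + P)
      expand = solve-∀

  first : ∀ {n} → (Fin n → Bool) → Maybe (Fin n)
  first {zero}  p = nothing
  first {suc n} p with p zero
  ... | true  = just zero
  ... | false = Maybe.map suc (first (p ∘ suc))

  first-cong : ∀ {n} {p q : Fin n → Bool} → (∀ i → p i ≡ q i) → first p ≡ first q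
  first-cong {zero}          p≗q = refl
  first-cong {suc n} {p} {q} p≗q with p zero | q zero | p≗q zero
  ... | true  | true  | _ = refl
  ... | false | false | _ = cong (Maybe.map suc) (first-cong (p≗q ∘ suc))

  first-just : ∀ {n} (p : Fin n → Bool) {i} → first p ≡ just i → p i ≡ true
  first-just {suc n} p {i} eq with p zero in p0
  first-just {suc n} p {zero} refl | true = p0
  ... | false with first (p ∘ suc) in eq′
  first-just {suc n} p {suc i} refl | false | just i = first-just (p ∘ suc) eq′

  first-nothing : ∀ {n} (p : Fin n → Bool) → first p ≡ nothing → ∀ i → p i ≡ false
  first-nothing {suc n} p eq i with p zero in p0
  first-nothing {suc n} p () i | true
  ... | false with first (p ∘ suc) in eq′
  first-nothing {suc n} p refl zero    | false | nothing = p0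
  first-nothing {suc n} p refl (suc i) | false | nothing = first-nothing (p ∘ suc) eq′ i

module Words where

  open Counting
  open import Data.Bool using (Bool; true; false)
  open import Data.Fin using (zero; suc)
  open import Data.Fin.Properties using (_≟_; any?; all?; ¬∀⟶∃¬; suc-injective)
  open import Data.Nat using (suc; _*_; _≤_)
  open import Data.Product using (∃; _×_; _,_; proj₁; proj₂)
  open import Data.Product.Properties using (≡-dec)
  open import Function using (_∘_)
  open import Relation.Binary.PropositionalEquality
  open import Relation.Nullary using (Dec; yes; no)

  -- zero is a blank, suc ℓ is the label ℓ.
  Word : ℕ → ℕ → Set
  Word r L = Fin r → Fin (suc L)

  isBlank : ∀ {L} → Fin (suc L) → Bool
  isBlank zero    = true
  isBlank (suc _) = false

  blanks : ∀ {r L} → Word r L → ℕ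
  blanks w = count (isBlank ∘ w)

  avoiding-word : ∀ {m r L} (key : Fin m → Fin r × Fin L) →
                  ∃ λ (h : Word r L) →
                    (∀ j → h (proj₁ (key j)) ≢ suc (proj₂ (key j))) × L * blanks h ≤ m
  avoiding-word {m} {r} {L} key = h , h-avoids , full-colours-bound key (isBlank ∘ h) blank⇒full
    where
    Hit : Fin r → Fin L → Set
    Hit c ℓ = ∃ λ j → key j ≡ (c , ℓ)
    hit? : ∀ c ℓ → Dec (Hit c ℓ)
    hit? c ℓ = any? λ j → ≡-dec _≟_ _≟_ (key j) (c , ℓ)
    h : Word r L
    h c with all? (hit? c)
    ... | yes _    = zero
    ... | no ¬full = suc (proj₁ (¬∀⟶∃¬ L (Hit c) (hit? c) ¬full))
    h-avoids : ∀ j → h (proj₁ (key j)) ≢ suc (proj₂ (key j))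
    h-avoids j with all? (hit? (proj₁ (key j)))
    ... | yes _    = λ ()
    ... | no ¬full = λ eq → proj₂ (¬∀⟶∃¬ L _ (hit? (proj₁ (key j))) ¬full)
                              (j , cong (proj₁ (key j) ,_) (sym (suc-injective eq)))
    blank⇒full : ∀ c → isBlank (h c) ≡ true → ∀ ℓ → Hit c ℓ
    blank⇒full c with all? (hit? c)
    ... | yes full = λ _ → full
    ... | no _     = λ ()

module BlankLabelGraph (r b L : ℕ) (b<r : b ℕ.< r) (ℓ₀ : Fin L) where

  open Counting
  open Words
  open import Data.Bool using (Bool; true; false; not; _∧_; _∨_)
  open import Data.Bool.Properties using (∧-zeroʳ; not-injective)
  open import Data.Empty using (⊥)
  open import Data.Fin using (zero; suc; fromℕ<)
  open import Data.Fin.Base using (finToFun; funToFin)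
  open import Data.Fin.Properties using (_≟_; finToFun-funToFin)
  open import Data.List using (List; _∷_)
  open import Data.List.Membership.Propositional using (_∈_)
  open import Data.List.Relation.Unary.Any using (here; there)
  open import Data.Maybe using (just; nothing; is-just; fromMaybe)
  open import Data.Nat using (suc; _+_; _*_; _^_; _≤_; _<?_; z≤n)
  open import Data.Nat.Properties hiding (_≟_)
  open import Data.Product using (∃; ∃₂; _×_; _,_; proj₁; proj₂)
  open import Function using (_∘_; id)
  open import Relation.Binary.PropositionalEquality
  open import Relation.Nullary using (yes; no; does; contradiction)
  open import Relation.Nullary.Decidable using (dec-true)

  n : ℕ
  n = suc L ^ r

  rawWord : Fin n → Word r L
  rawWord = finToFun

  fillBlank : Fin (suc L) → Fin (suc L)
  fillBlank zero    = suc ℓ₀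
  fillBlank (suc ℓ) = suc ℓ

  -- Capping the number of blanks at b (blanks-word≤) is what keeps all degrees large.
  word : Fin n → Word r L
  word v with b <? blanks (rawWord v)
  ... | yes _ = fillBlank ∘ rawWord v
  ... | no  _ = rawWord v

  word-label : ∀ v {c ℓ} → rawWord v c ≡ suc ℓ → word v c ≡ suc ℓ
  word-label v {c} raw≡ℓ with b <? blanks (rawWord v)
  ... | yes _ rewrite raw≡ℓ = refl
  ... | no  _ = raw≡ℓ

  word-unsaturated : ∀ v → blanks (rawWord v) ≤ b → ∀ c → word v c ≡ rawWord v c
  word-unsaturated v blanks≤b c with b <? blanks (rawWord v)
  ... | yes b<blanks = contradiction blanks≤b (<⇒≱ b<blanks)
  ... | no  _        = refl

  blanks-word≤ : ∀ v → blanks (word v) ≤ b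
  blanks-word≤ v with b <? blanks (rawWord v)
  ... | yes _        = ≤-trans (≤-reflexive (count-false (isBlank-fillBlank ∘ rawWord v))) z≤n
    where
    isBlank-fillBlank : ∀ x → isBlank (fillBlank x) ≡ false
    isBlank-fillBlank zero    = refl
    isBlank-fillBlank (suc _) = refl
  ... | no  b≮blanks = ≮⇒≥ b≮blanks

  labelled-coordinate : ∀ v → ∃₂ λ c ℓ → word v c ≡ suc ℓ
  labelled-coordinate v with count<n⇒false (isBlank ∘ word v) (≤-<-trans (blanks-word≤ v) b<r)
  ... | c , notBlank = c , unblank (word v c) notBlank
    where
    unblank : ∀ x → isBlank x ≡ false → ∃ λ ℓ → x ≡ suc ℓ
    unblank (suc ℓ) _ = ℓ , refl

  sameLabel : Fin (suc L) → Fin (suc L) → Bool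
  sameLabel zero    _        = false
  sameLabel (suc _) zero     = false
  sameLabel (suc ℓ) (suc ℓ′) = does (ℓ ≟ ℓ′)

  sameLabel-sym : ∀ x y → sameLabel x y ≡ sameLabel y x
  sameLabel-sym zero    zero     = refl
  sameLabel-sym zero    (suc _)  = refl
  sameLabel-sym (suc _) zero     = refl
  sameLabel-sym (suc ℓ) (suc ℓ′) = does-≟-sym ℓ ℓ′

  sameLabel-refl : ∀ ℓ → sameLabel (suc ℓ) (suc ℓ) ≡ true
  sameLabel-refl ℓ = dec-true (ℓ ≟ ℓ) refl

  sameLabel⇒≡ : ∀ x y → sameLabel x y ≡ true → ∃ λ ℓ → x ≡ suc ℓ × y ≡ suc ℓ
  sameLabel⇒≡ (suc ℓ) (suc ℓ′) same with ℓ ≟ ℓ′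
  ... | yes refl = ℓ , refl , refl

  sameLabel-rawWord : ∀ x v c → sameLabel x (rawWord v c) ≡ true → sameLabel x (word v c) ≡ true
  sameLabel-rawWord x v c same with sameLabel⇒≡ x (rawWord v c) same
  ... | ℓ , refl , vℓ = trans (cong (sameLabel (suc ℓ)) (word-label v vℓ)) (sameLabel-refl ℓ)

  shared : Fin n → Fin n → Fin r → Bool
  shared u v c = sameLabel (word u c) (word v c)

  first-shared-sym : ∀ u v → first (shared u v) ≡ first (shared v u)
  first-shared-sym u v = first-cong λ c → sameLabel-sym (word u c) (word v c)

  adjacent : Fin n → Fin n → Bool
  adjacent u v = not (does (u ≟ v)) ∧ is-just (first (shared u v))

  -- The default colour fromℕ< b<r is only used on non-edges.
  edgeColour : Fin n → Fin n → Fin r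
  edgeColour u v = fromMaybe (fromℕ< b<r) (first (shared u v))

  adjacent-irr : ∀ u → adjacent u u ≡ true → ⊥
  adjacent-irr u uu rewrite dec-true (u ≟ u) refl with uu
  ... | ()

  G : ColouredGraph n r
  G = record
    { adj        = adjacent
    ; adj-sym    = λ u v → cong₂ (λ x y → not x ∧ is-just y) (does-≟-sym u v) (first-shared-sym u v)
    ; adj-irr    = adjacent-irr
    ; colour     = edgeColour
    ; colour-sym = λ u v _ → cong (fromMaybe (fromℕ< b<r)) (first-shared-sym u v)
    }

  edge-label : ∀ {u v} → adjacent u v ≡ true →
               ∃ λ ℓ → word u (edgeColour u v) ≡ suc ℓ × word v (edgeColour u v) ≡ suc ℓ
  edge-label {u} {v} uv with first (shared u v) in first≡
  ... | just c  = sameLabel⇒≡ (word u c) (word v c) (first-just (shared u v) first≡)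
  ... | nothing = contradiction (trans (sym uv) (∧-zeroʳ (not (does (u ≟ v))))) λ ()

  LabelledAt : Fin r → Fin L → List (Fin n) → Set
  LabelledAt c ℓ T = ∀ {w} → w ∈ T → word w c ≡ suc ℓ

  grow-labelledAt : ∀ {i T} → MonoTree G i T →
                    ∀ {u v} → u ∈ T → adjacent u v ≡ true → edgeColour u v ≡ i →
                    ∃ λ ℓ → LabelledAt i ℓ (v ∷ T)
  grow-labelledAt (single x) (here refl) uv refl with edge-label uv
  ... | ℓ , xℓ , vℓ = ℓ , λ { (here refl) → vℓ ; (there (here refl)) → xℓ }
  grow-labelledAt (grow t _ _ u′∈T _ u′v′ col′) {u} u∈T uv refl
    with grow-labelledAt t u′∈T u′v′ col′ | edge-label uv
  ... | ℓ , labelled | ℓ′ , uℓ′ , vℓ′ =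
    ℓ , λ { (here refl)  → trans vℓ′ (trans (sym uℓ′) (labelled u∈T))
          ; (there w∈T) → labelled w∈T }

  monoTree-labelledAt : ∀ {i T} → MonoTree G i T → ∃₂ λ c ℓ → LabelledAt c ℓ T
  monoTree-labelledAt (single v) with labelled-coordinate v
  ... | c , ℓ , vℓ = c , ℓ , λ { (here refl) → vℓ }
  monoTree-labelledAt {i} (grow t u v u∈T _ uv col) = i , grow-labelledAt t u∈T uv col

  treeLabel : MonochromaticTree G → Fin r × Fin L
  treeLabel (_ , _ , t) = proj₁ (monoTree-labelledAt t) , proj₁ (proj₂ (monoTree-labelledAt t))

  treeLabel-labelledAt : (t : MonochromaticTree G) →
                         LabelledAt (proj₁ (treeLabel t)) (proj₂ (treeLabel t)) (treeVertices t)
  treeLabel-labelledAt (_ , _ , t) = proj₂ (proj₂ (monoTree-labelledAt t))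

  cover-lower-bound : ∀ m (ts : Fin m → MonochromaticTree G) → Covers G m ts → suc b * L ≤ m
  cover-lower-bound m ts covers with avoiding-word (treeLabel ∘ ts)
  ... | h , h-avoids , L*blanks≤m with b <? blanks h
  ...   | yes b<blanks = begin
    suc b * L      ≡⟨ *-comm (suc b) L ⟩
    L * suc b      ≤⟨ *-monoʳ-≤ L b<blanks ⟩
    L * blanks h   ≤⟨ L*blanks≤m ⟩
    m              ∎
    where open ≤-Reasoning
  ...   | no  b≮blanks with covers (funToFin h)
  ...     | j , w∈tree = contradiction h-hit (h-avoids j)
    where
    w : Fin n
    w = funToFin h
    rawWord-w : ∀ c → rawWord w c ≡ h c
    rawWord-w = finToFun-funToFin h
    blanks-rawWord-w : blanks (rawWord w) ≡ blanks h
    blanks-rawWord-w = sum-cong-≗ {r} λ c → cong (indicator ∘ isBlank) (rawWord-w c)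
    word-w : ∀ c → word w c ≡ h c
    word-w c = trans (word-unsaturated w (subst (_≤ b) (sym blanks-rawWord-w) (≮⇒≥ b≮blanks)) c)
                     (rawWord-w c)
    h-hit : h (proj₁ (treeLabel (ts j))) ≡ suc (proj₂ (treeLabel (ts j)))
    h-hit = trans (sym (word-w _)) (treeLabel-labelledAt (ts j) w∈tree)

  -- Non-neighbours are counted through raw words so that the count factorises over the
  -- coordinates; a non-neighbour v ≠ u avoids u because filling blanks only adds labels.
  avoids : Fin n → Fin n → Bool
  avoids u v = allᵇ λ c → not (sameLabel (word u c) (rawWord v c))

  avoiders : Fin n → ℕ
  avoiders u = count (avoids u)

  non-adjacent : ∀ u v → adjacent u v ≡ false → does (u ≟ v) ∨ avoids u v ≡ true
  non-adjacent u v ¬uv with does (u ≟ v) | first (shared u v) in first≡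
  ... | true  | _       = refl
  ... | false | nothing =
    allᵇ-true λ c → not-sameLabel-raw c (first-nothing (shared u v) first≡ c)
    where
    not-sameLabel-raw : ∀ c → shared u v c ≡ false →
                        not (sameLabel (word u c) (rawWord v c)) ≡ true
    not-sameLabel-raw c ¬shared with sameLabel (word u c) (rawWord v c) in same
    ... | false = refl
    ... | true  = contradiction (trans (sym (sameLabel-rawWord (word u c) v c same)) ¬shared) λ ()

  n≤degree+suc-avoiders : ∀ u → n ≤ degree G u + suc (avoiders u)
  n≤degree+suc-avoiders u = begin
    n
      ≡⟨ count-complement (adjacent u) ⟨
    count (adjacent u) + count (not ∘ adjacent u)
      ≤⟨ +-monoʳ-≤ (count (adjacent u)) non-neighbours ⟩
    count (adjacent u) + (count (λ v → does (u ≟ v)) + avoiders u)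
      ≡⟨ cong₂ (λ d s → d + (s + avoiders u))
               (length-filterᵇ-tabulate (adjacent u) id) (sym (count-≟ u)) ⟨
    degree G u + suc (avoiders u) ∎
    where
    open ≤-Reasoning
    non-neighbours : count (not ∘ adjacent u) ≤ count (λ v → does (u ≟ v)) + avoiders u
    non-neighbours = ≤-trans (count-mono-≤ λ v ¬uv → non-adjacent u v (not-injective ¬uv))
                             (count-∨ (λ v → does (u ≟ v)) (avoids u))

  count-not-sameLabel : ∀ x → count (λ y → not (sameLabel x y)) ≡ indicator (isBlank x) + L
  count-not-sameLabel zero    = trans (∑-const (suc L) 1) (*-identityʳ (suc L))
  count-not-sameLabel (suc ℓ) =
    trans (cong (_+ count (λ y → not (does (ℓ ≟ y)))) (sym (count-≟ ℓ)))
          (count-complement λ y → does (ℓ ≟ y))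

  avoiders-bound : ∀ {k} → b + k ≤ r → ∀ u → avoiders u * (L + k) ≤ L * n
  avoiders-bound {k} b+k≤r u = begin
    avoiders u * (L + k)                  ≡⟨ cong (_* (L + k)) avoiders≡product ⟩
    P * (L + k)                           ≤⟨ *-monoʳ-≤ P (+-monoʳ-≤ L k≤labelled) ⟩
    P * (L + count (not ∘ Q))             ≤⟨ bernoulli L Q ⟩
    L * n                                 ∎
    where
    open ≤-Reasoning
    Q : Fin r → Bool
    Q = isBlank ∘ word u
    P : ℕ
    P = product (λ c → indicator (Q c) + L)
    avoiders≡product : avoiders u ≡ P
    avoiders≡product = trans (count-allᵇ-finToFun r λ c → not ∘ sameLabel (word u c))
                             (product-cong-≗ {r} λ c → count-not-sameLabel (word u c))
    k≤labelled : k ≤ count (not ∘ Q)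
    k≤labelled = +-cancelˡ-≤ b k (count (not ∘ Q)) (begin
      b + k                        ≤⟨ b+k≤r ⟩
      r                            ≡⟨ count-complement Q ⟨
      count Q + count (not ∘ Q)    ≤⟨ +-monoˡ-≤ (count (not ∘ Q)) (blanks-word≤ u) ⟩
      b + count (not ∘ Q)          ∎)

module Arithmetic where

  open import Data.Nat
  open import Data.Nat.Properties
  open import Data.Nat.DivMod using (_/_; _%_; m≡m%n+[m/n]*n; m%n<n; m/n*n≤m)
  open import Data.Nat.Tactic.RingSolver using (solve)
  open import Data.List using ([]; _∷_)
  open import Relation.Binary.PropositionalEquality

  m<n*suc[m/n] : ∀ m n .{{_ : NonZero n}} → m < n * suc (m / n)
  m<n*suc[m/n] m n = begin-strict
    m                    ≡⟨ m≡m%n+[m/n]*n m n ⟩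
    m % n + m / n * n    <⟨ +-monoˡ-< (m / n * n) (m%n<n m n) ⟩
    n + m / n * n        ≡⟨ cong (n +_) (*-comm (m / n) n) ⟩
    n + n * (m / n)      ≡⟨ *-suc n (m / n) ⟨
    n * suc (m / n)      ∎
    where open ≤-Reasoning

  n*suc[m/n]≤n+m : ∀ m n .{{_ : NonZero n}} → n * suc (m / n) ≤ n + m
  n*suc[m/n]≤n+m m n = begin
    n * suc (m / n)      ≡⟨ *-suc n (m / n) ⟩
    n + n * (m / n)      ≡⟨ cong (n +_) (*-comm n (m / n)) ⟩
    n + m / n * n        ≤⟨ +-monoʳ-≤ n (m/n*n≤m m n) ⟩
    n + m                ∎
    where open ≤-Reasoning

  ⌈n/2⌉≤1+⌊n/2⌋ : ∀ n → ⌈ n /2⌉ ≤ suc ⌊ n /2⌋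
  ⌈n/2⌉≤1+⌊n/2⌋ zero          = z≤n
  ⌈n/2⌉≤1+⌊n/2⌋ (suc zero)    = ≤-refl
  ⌈n/2⌉≤1+⌊n/2⌋ (suc (suc n)) = s≤s (⌈n/2⌉≤1+⌊n/2⌋ n)

  n<2^n : ∀ n → n < 2 ^ n
  n<2^n zero    = z<s
  n<2^n (suc n) = +-mono-≤ (m^n>0 2 n) (≤-trans (n<2^n n) (m≤m+n (2 ^ n) 0))

  degree-arith-ε≤1 : ∀ {p q k L n d X} .{{_ : NonZero p}} → p ≤ q → q ≤ k → q ≤ n →
                     q * q * L ≤ q * q + p * p * k → n ≤ d + suc X → X * (L + k) ≤ L * n →
                     q * n ≤ q * d + 4 * p * n
  degree-arith-ε≤1 {p} {q} {k} {L} {n} {d} {X} p≤q q≤k q≤n L-bound n≤d+1+X X-bound = begin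
    q * n                            ≤⟨ *-monoʳ-≤ q n≤d+1+X ⟩
    q * (d + suc X)                  ≡⟨ solve (q ∷ d ∷ X ∷ []) ⟩
    q * d + (q + q * X)              ≤⟨ +-monoʳ-≤ (q * d) (+-mono-≤ q≤2pn qX≤2pn) ⟩
    q * d + (2 * p * n + 2 * p * n)  ≡⟨ cong (q * d +_) (solve (p ∷ n ∷ [])) ⟩
    q * d + 4 * p * n                ∎
    where
    open ≤-Reasoning
    instance
      q≢0 : NonZero q
      q≢0 = >-nonZero (≤-trans (>-nonZero⁻¹ p) p≤q)
      k≢0 : NonZero k
      k≢0 = >-nonZero (≤-trans (>-nonZero⁻¹ q) q≤k)
    q≤2pn : q ≤ 2 * p * n
    q≤2pn = ≤-trans q≤n (≤-trans (m≤n*m n p) (*-monoˡ-≤ n (m≤n*m p 2)))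
    qX≤2pn : q * X ≤ 2 * p * n
    qX≤2pn = *-cancelˡ-≤ (q * k) {{m*n≢0 q k}} (begin
      q * k * (q * X)                ≡⟨ solve (q ∷ k ∷ X ∷ []) ⟩
      q * q * (X * k)                ≤⟨ *-monoʳ-≤ (q * q) (*-monoʳ-≤ X (m≤n+m k L)) ⟩
      q * q * (X * (L + k))          ≤⟨ *-monoʳ-≤ (q * q) X-bound ⟩
      q * q * (L * n)                ≡⟨ *-assoc (q * q) L n ⟨
      q * q * L * n                  ≤⟨ *-monoˡ-≤ n L-bound ⟩
      (q * q + p * p * k) * n        ≤⟨ *-monoˡ-≤ n (+-mono-≤ qq≤pqk ppk≤pqk) ⟩
      (p * q * k + p * q * k) * n    ≡⟨ solve (p ∷ q ∷ k ∷ n ∷ []) ⟩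
      q * k * (2 * p * n)            ∎)
      where
      ppk≤pqk : p * p * k ≤ p * q * k
      ppk≤pqk = *-monoˡ-≤ k (*-monoʳ-≤ p p≤q)
      qq≤pqk : q * q ≤ p * q * k
      qq≤pqk = begin
        q * q          ≤⟨ *-monoʳ-≤ q q≤k ⟩
        q * k          ≤⟨ m≤n*m (q * k) p ⟩
        p * (q * k)    ≡⟨ *-assoc p q k ⟨
        p * q * k      ∎

  degree-arith-ε≥1 : ∀ {p q n d} → q ≤ p → q * n ≤ q * d + 4 * p * n
  degree-arith-ε≥1 {p} {q} {n} {d} q≤p = begin
    q * n              ≤⟨ *-monoˡ-≤ n q≤p ⟩
    p * n              ≤⟨ m≤n*m (p * n) 4 ⟩
    4 * (p * n)        ≡⟨ *-assoc 4 p n ⟨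
    4 * p * n          ≤⟨ m≤n+m (4 * p * n) (q * d) ⟩
    q * d + 4 * p * n  ∎
    where open ≤-Reasoning

  cover-arith : ∀ {p q r b k L m} → r ≤ 2 * suc b → r ≤ 2 * k →
                p * p * k ≤ q * q * L → suc b * L ≤ m →
                p * p * (r * r) ≤ 4 * (q * q * m)
  cover-arith {p} {q} {r} {b} {k} {L} {m} r≤2[1+b] r≤2k L-bound covers = begin
    p * p * (r * r)                      ≤⟨ *-monoʳ-≤ (p * p) (*-mono-≤ r≤2[1+b] r≤2k) ⟩
    p * p * (2 * suc b * (2 * k))        ≡⟨ solve (p ∷ b ∷ k ∷ []) ⟩
    4 * suc b * (p * p * k)              ≤⟨ *-monoʳ-≤ (4 * suc b) L-bound ⟩
    4 * suc b * (q * q * L)              ≡⟨ solve (b ∷ q ∷ L ∷ []) ⟩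
    4 * (q * q * (suc b * L))            ≤⟨ *-monoʳ-≤ 4 (*-monoʳ-≤ (q * q) covers) ⟩
    4 * (q * q * m)                      ∎
    where open ≤-Reasoning

module RationalBounds where

  open import Data.Nat using (suc; z≤n; s≤s)
  import Data.Nat.Properties as ℕ
  open import Data.Integer as ℤ using (+_; +[1+_]; +0; -[1+_])
  import Data.Integer.Properties as ℤ
  open import Data.Product using (∃₂; _,_)
  open import Data.Rational using (ℚ; mkℚ; _<_; _≤_; _*_; _+_; _-_; -_; _/_; 0ℚ; 1ℚ; toℚᵘ; positive; *<*)
  open import Data.Rational.Properties
  open import Data.Rational.Solver using (module +-*-Solver)
  open import Data.Rational.Unnormalised as ℚᵘ using (mkℚᵘ; *≡*; *≤*)
  import Data.Rational.Unnormalised.Properties as ℚᵘ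
  open import Relation.Binary.PropositionalEquality
  open +-*-Solver

  toℚᵘ-toℚ : ∀ a → toℚᵘ (toℚ a) ℚᵘ.≃ mkℚᵘ (+ a) 0
  toℚᵘ-toℚ a = toℚᵘ-fromℚᵘ (mkℚᵘ (+ a) 0)

  toℚ-+ : ∀ a b → toℚ (a ℕ.+ b) ≡ toℚ a + toℚ b
  toℚ-+ a b = toℚᵘ-injective (begin-equality
    toℚᵘ (toℚ (a ℕ.+ b))                   ≃⟨ toℚᵘ-toℚ (a ℕ.+ b) ⟩
    mkℚᵘ (+ (a ℕ.+ b)) 0                   ≃⟨ *≡* integral ⟩
    mkℚᵘ (+ a) 0 ℚᵘ.+ mkℚᵘ (+ b) 0         ≃⟨ ℚᵘ.+-cong (toℚᵘ-toℚ a) (toℚᵘ-toℚ b) ⟨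
    toℚᵘ (toℚ a) ℚᵘ.+ toℚᵘ (toℚ b)         ≃⟨ toℚᵘ-homo-+ (toℚ a) (toℚ b) ⟨
    toℚᵘ (toℚ a + toℚ b)                   ∎)
    where
    open ℚᵘ.≤-Reasoning
    integral : + (a ℕ.+ b) ℤ.* + 1 ≡ (+ a ℤ.* + 1 ℤ.+ + b ℤ.* + 1) ℤ.* + 1
    integral = trans (ℤ.*-identityʳ _) (trans (ℤ.pos-+ a b) (sym (trans (ℤ.*-identityʳ _)
                 (cong₂ ℤ._+_ (ℤ.*-identityʳ (+ a)) (ℤ.*-identityʳ (+ b))))))

  toℚ-* : ∀ a b → toℚ (a ℕ.* b) ≡ toℚ a * toℚ b
  toℚ-* a b = toℚᵘ-injective (begin-equality
    toℚᵘ (toℚ (a ℕ.* b))                   ≃⟨ toℚᵘ-toℚ (a ℕ.* b) ⟩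
    mkℚᵘ (+ (a ℕ.* b)) 0                   ≃⟨ *≡* (cong (ℤ._* + 1) (ℤ.pos-* a b)) ⟩
    mkℚᵘ (+ a) 0 ℚᵘ.* mkℚᵘ (+ b) 0         ≃⟨ ℚᵘ.*-cong (toℚᵘ-toℚ a) (toℚᵘ-toℚ b) ⟨
    toℚᵘ (toℚ a) ℚᵘ.* toℚᵘ (toℚ b)         ≃⟨ toℚᵘ-homo-* (toℚ a) (toℚ b) ⟨
    toℚᵘ (toℚ a * toℚ b)                   ∎)
    where open ℚᵘ.≤-Reasoning

  toℚ-mono-≤ : ∀ {a b} → a ℕ.≤ b → toℚ a ≤ toℚ b
  toℚ-mono-≤ {a} {b} a≤b = toℚᵘ-cancel-≤ (begin
    toℚᵘ (toℚ a)    ≃⟨ toℚᵘ-toℚ a ⟩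
    mkℚᵘ (+ a) 0    ≤⟨ *≤* (ℤ.*-monoʳ-≤-nonNeg (+ 1) (ℤ.+≤+ a≤b)) ⟩
    mkℚᵘ (+ b) 0    ≃⟨ toℚᵘ-toℚ b ⟨
    toℚᵘ (toℚ b)    ∎)
    where open ℚᵘ.≤-Reasoning

  toℚ-mono-< : ∀ {a b} → a ℕ.< b → toℚ a < toℚ b
  toℚ-mono-< {a} {b} a<b = toℚᵘ-cancel-< (begin-strict
    toℚᵘ (toℚ a)    ≃⟨ toℚᵘ-toℚ a ⟩
    mkℚᵘ (+ a) 0    <⟨ ℚᵘ.*<* (ℤ.*-monoʳ-<-pos (+ 1) (ℤ.+<+ a<b)) ⟩
    mkℚᵘ (+ b) 0    ≃⟨ toℚᵘ-toℚ b ⟨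
    toℚᵘ (toℚ b)    ∎)
    where open ℚᵘ.≤-Reasoning

  toℚ-positive : ∀ a → 0ℚ < toℚ (suc a)
  toℚ-positive a = toℚ-mono-< {0} {suc a} (s≤s z≤n)

  positive-ratio : ∀ {ε} → 0ℚ < ε → ∃₂ λ p q → toℚ (suc q) * ε ≡ toℚ (suc p)
  positive-ratio {mkℚ +[1+ p ] q _} _ = p , q , toℚᵘ-injective (begin-equality
    toℚᵘ (toℚ (suc q) * ε)                 ≃⟨ toℚᵘ-homo-* (toℚ (suc q)) ε ⟩
    toℚᵘ (toℚ (suc q)) ℚᵘ.* mkℚᵘ (+ suc p) q ≃⟨ ℚᵘ.*-congʳ (toℚᵘ-toℚ (suc q)) ⟩
    mkℚᵘ (+ suc q) 0 ℚᵘ.* mkℚᵘ (+ suc p) q ≃⟨ *≡* integral ⟩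
    mkℚᵘ (+ suc p) 0                       ≃⟨ toℚᵘ-toℚ (suc p) ⟨
    toℚᵘ (toℚ (suc p))                     ∎)
    where
    open ℚᵘ.≤-Reasoning
    ε = mkℚ +[1+ p ] q _
    integral : (+ suc q ℤ.* + suc p) ℤ.* + 1 ≡ + suc p ℤ.* + suc (q ℕ.+ 0 ℕ.* suc q)
    integral = trans (ℤ.*-identityʳ _) (trans (ℤ.*-comm (+ suc q) (+ suc p))
                 (cong (λ x → + suc p ℤ.* + suc x) (sym (ℕ.+-identityʳ q))))
  positive-ratio {mkℚ +0       _ _} (*<* (ℤ.+<+ ()))
  positive-ratio {mkℚ -[1+ _ ] _ _} (*<* ())

  min-degree-ℚ : ∀ {ε} p q n d → toℚ (suc q) * ε ≡ toℚ p →
                 suc q ℕ.* n ℕ.≤ suc q ℕ.* d ℕ.+ 4 ℕ.* p ℕ.* n →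
                 (1ℚ - toℚ 4 * ε) * toℚ n ≤ toℚ d
  min-degree-ℚ {ε} p q n d q*ε≡p bound = begin
    (1ℚ - F * ε) * N
      ≡⟨ solve 3 (λ f e x → (con 1ℚ :- f :* e) :* x := x :- f :* e :* x) refl F ε N ⟩
    N - F * ε * N
      ≤⟨ +-monoˡ-≤ (- (F * ε * N)) N≤D+FεN ⟩
    D + F * ε * N - F * ε * N
      ≡⟨ solve 2 (λ x y → x :+ y :- y := x) refl D (F * ε * N) ⟩
    D ∎
    where
    open ≤-Reasoning
    Q N D F : ℚ
    Q = toℚ (suc q)
    N = toℚ n
    D = toℚ d
    F = toℚ 4
    bound-ℚ : Q * N ≤ Q * D + F * toℚ p * N
    bound-ℚ = subst₂ _≤_ (toℚ-* (suc q) n)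
                (trans (toℚ-+ (suc q ℕ.* d) (4 ℕ.* p ℕ.* n))
                       (cong₂ _+_ (toℚ-* (suc q) d)
                                  (trans (toℚ-* (4 ℕ.* p) n) (cong (_* N) (toℚ-* 4 p)))))
                (toℚ-mono-≤ bound)
    N≤D+FεN : N ≤ D + F * ε * N
    N≤D+FεN = *-cancelˡ-≤-pos Q {{positive (toℚ-positive q)}} (begin
      Q * N
        ≤⟨ bound-ℚ ⟩
      Q * D + F * toℚ p * N
        ≡⟨ cong (λ x → Q * D + F * x * N) q*ε≡p ⟨
      Q * D + F * (Q * ε) * N
        ≡⟨ solve 5 (λ q d f e x → q :* d :+ f :* (q :* e) :* x := q :* (d :+ f :* e :* x))
                 refl Q D F ε N ⟩
      Q * (D + F * ε * N) ∎)

  cover-number-ℚ : ∀ {ε} p q r m → toℚ (suc q) * ε ≡ toℚ p → 1 ℕ.≤ r →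
                   p ℕ.* p ℕ.* (r ℕ.* r) ℕ.≤ 4 ℕ.* (suc q ℕ.* suc q ℕ.* m) →
                   ε * ε * ((toℚ r - 1ℚ) * (toℚ r - 1ℚ)) * (+ 1 / 4) ≤ toℚ m
  cover-number-ℚ {ε} p q (suc r) m q*ε≡p _ bound = begin
    ε * ε * ((toℚ (suc r) - 1ℚ) * (toℚ (suc r) - 1ℚ)) * ¼
      ≡⟨ cong (λ x → ε * ε * (x * x) * ¼) r+1-1≡r ⟩
    ε * ε * (R * R) * ¼
      ≤⟨ *-monoʳ-≤-nonNeg ¼ ε²R²≤FM ⟩
    F * M * ¼
      ≡⟨ solve 1 (λ x → con F :* x :* con ¼ := x) refl M ⟩
    M ∎
    where
    open ≤-Reasoning
    ¼ Q R M F : ℚ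
    ¼ = + 1 / 4
    Q = toℚ (suc q)
    R = toℚ r
    M = toℚ m
    F = toℚ 4
    r+1-1≡r : toℚ (suc r) - 1ℚ ≡ R
    r+1-1≡r = trans (cong (_- 1ℚ) (toℚ-+ 1 r))
                    (solve 1 (λ x → con 1ℚ :+ x :- con 1ℚ := x) refl R)
    p²r²≤p²[1+r]² : p ℕ.* p ℕ.* (r ℕ.* r) ℕ.≤ p ℕ.* p ℕ.* (suc r ℕ.* suc r)
    p²r²≤p²[1+r]² = ℕ.*-monoʳ-≤ (p ℕ.* p) (ℕ.*-mono-≤ (ℕ.n≤1+n r) (ℕ.n≤1+n r))
    bound-ℚ : toℚ p * toℚ p * (R * R) ≤ F * (Q * Q * M)
    bound-ℚ = subst₂ _≤_
                (trans (toℚ-* (p ℕ.* p) (r ℕ.* r)) (cong₂ _*_ (toℚ-* p p) (toℚ-* r r)))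
                (trans (toℚ-* 4 (suc q ℕ.* suc q ℕ.* m))
                       (cong (F *_) (trans (toℚ-* (suc q ℕ.* suc q) m)
                                           (cong (_* M) (toℚ-* (suc q) (suc q))))))
                (toℚ-mono-≤ (ℕ.≤-trans p²r²≤p²[1+r]² bound))
    Q*Q-positive : 0ℚ < Q * Q
    Q*Q-positive = subst (0ℚ <_) (toℚ-* (suc q) (suc q)) (toℚ-positive (q ℕ.+ q ℕ.* suc q))
    ε²R²≤FM : ε * ε * (R * R) ≤ F * M
    ε²R²≤FM = *-cancelˡ-≤-pos (Q * Q) {{positive Q*Q-positive}} (begin
      Q * Q * (ε * ε * (R * R))
        ≡⟨ solve 3 (λ x e y → x :* x :* (e :* e :* (y :* y)) := (x :* e) :* (x :* e) :* (y :* y))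
                 refl Q ε R ⟩
      Q * ε * (Q * ε) * (R * R)
        ≡⟨ cong (λ x → x * x * (R * R)) q*ε≡p ⟩
      toℚ p * toℚ p * (R * R)
        ≤⟨ bound-ℚ ⟩
      F * (Q * Q * M)
        ≡⟨ solve 3 (λ f x y → f :* (x :* x :* y) := x :* x :* (f :* y)) refl F Q M ⟩
      Q * Q * (F * M) ∎)

module ParameterChoice (p′ q′ r : ℕ) (2q≤r : 2 ℕ.* ℕ.suc q′ ℕ.≤ r) where

  open Arithmetic
  open import Data.Fin using (zero)
  open import Data.Nat
  open import Data.Nat.Properties
  open import Data.Nat.DivMod using (_/_)
  open import Relation.Binary.PropositionalEquality
  open import Relation.Nullary using (yes; no)

  -- L ≈ ε² k is large enough for (b+1) L ≥ ε² r² / 4 and, when ε ≤ 1, small enough for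
  -- L n / (L + k) ≤ 2εn.
  p q b k L : ℕ
  p = suc p′
  q = suc q′
  b = ⌊ r /2⌋
  k = ⌈ r /2⌉
  L = suc (p * p * k / (q * q))

  b+k≡r : b + k ≡ r
  b+k≡r = ⌊n/2⌋+⌈n/2⌉≡n r

  r≤2k : r ≤ 2 * k
  r≤2k = begin
    r          ≡⟨ b+k≡r ⟨
    b + k      ≤⟨ +-monoˡ-≤ k (⌊n/2⌋≤⌈n/2⌉ r) ⟩
    k + k      ≡⟨ cong (k +_) (+-identityʳ k) ⟨
    2 * k      ∎
    where open ≤-Reasoning

  r≤2[1+b] : r ≤ 2 * suc b
  r≤2[1+b] = begin
    r              ≡⟨ b+k≡r ⟨
    b + k          ≤⟨ +-mono-≤ (n≤1+n b) (⌈n/2⌉≤1+⌊n/2⌋ r) ⟩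
    suc b + suc b  ≡⟨ cong (suc b +_) (+-identityʳ (suc b)) ⟨
    2 * suc b      ∎
    where open ≤-Reasoning

  q≤k : q ≤ k
  q≤k = *-cancelˡ-≤ 2 (≤-trans 2q≤r r≤2k)

  b<r : b < r
  b<r = begin-strict
    b       <⟨ m<m+n b (≤-trans z<s q≤k) ⟩
    b + k   ≡⟨ b+k≡r ⟩
    r       ∎
    where open ≤-Reasoning

  1≤r : 1 ≤ r
  1≤r = ≤-trans (s≤s z≤n) 2q≤r

  open BlankLabelGraph r b L b<r zero public using (n; G)
  open BlankLabelGraph r b L b<r zero using (n≤degree+suc-avoiders; avoiders-bound; cover-lower-bound)

  q≤n : q ≤ n
  q≤n = begin
    q          ≤⟨ q≤k ⟩
    k          ≤⟨ ⌈n/2⌉≤n r ⟩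
    r          <⟨ n<2^n r ⟩
    2 ^ r      ≤⟨ ^-monoˡ-≤ r (s≤s (s≤s z≤n)) ⟩
    suc L ^ r  ∎
    where open ≤-Reasoning

  min-degree-ℕ : ∀ v → q * n ≤ q * degree G v + 4 * p * n
  min-degree-ℕ v with p ≤? q
  ... | yes p≤q = degree-arith-ε≤1 {L = L} p≤q q≤k q≤n (n*suc[m/n]≤n+m (p * p * k) (q * q))
                    (n≤degree+suc-avoiders v) (avoiders-bound (≤-reflexive b+k≡r) v)
  ... | no  p≰q = degree-arith-ε≥1 {p} {q} {n} {degree G v} (≰⇒≥ p≰q)

  cover-number-ℕ : ∀ m ts → Covers G m ts → p * p * (r * r) ≤ 4 * (q * q * m)
  cover-number-ℕ m ts covers =
    cover-arith {p} {q} r≤2[1+b] r≤2k (<⇒≤ (m<n*suc[m/n] (p * p * k) (q * q)))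
                (cover-lower-bound m ts covers)

open import Data.Nat using (_≥_)
open import Data.Product using (Σ; ∃; _×_; _,_)
open import Data.Integer using (+_)
open import Data.Rational using (ℚ; _<_; _≤_; _*_; _-_; _/_; 0ℚ; 1ℚ)
open RationalBounds using (positive-ratio; min-degree-ℚ; cover-number-ℚ)

proposition1p3 : (ε : ℚ) → 0ℚ < ε →
    ∃ λ (r₀ : ℕ) → (r : ℕ) → r ≥ r₀ →
      ∃ λ (n : ℕ) → Σ (ColouredGraph n r) λ G →
        ((v : Fin n) → (1ℚ - toℚ 4 * ε) * toℚ n ≤ toℚ (degree G v))
        × ((m : ℕ) → (ts : Fin m → MonochromaticTree G) → Covers G m ts →
            (ε * ε * ((toℚ r - 1ℚ) * (toℚ r - 1ℚ))) * (+ 1 / 4) ≤ toℚ m)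
proposition1p3 ε 0<ε with positive-ratio 0<ε
... | p′ , q′ , q*ε≡p = 2 ℕ.* ℕ.suc q′ , λ r 2q≤r →
  let open ParameterChoice p′ q′ r 2q≤r in
  n , G , (λ v → min-degree-ℚ p q′ n (degree G v) q*ε≡p (min-degree-ℕ v)) ,
  λ m ts covers → cover-number-ℚ p q′ r m q*ε≡p 1≤r (cover-number-ℕ m ts covers)
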